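{- Let $G=(\Sigma_G,V_G,E_G,\mathcal{M},\mathcal{U},\mathcal{X},\mathcal{C})$ be a guest whose choice function is $\mathcal{C}(x)=\{\mathrm{out}(x)\}$ for every $x\in V_G$, let $H=(\Sigma_H,V_H,E_H)$ be a host graph, and let $S=(\Sigma_G\cap\Sigma_H,V^{G\to H},E^{G\to H})$ be a subgraph of the tensor product $G\times H$. If $S$ satisfies condition (LGS4) below, then $S$ also satisfies condition (LGS5) below. (LGS4): for each $(u,u')\in V^{G\to H}$ there exists $\gamma\in\mathcal{C}(u)$ such that for all $(u,a,v)\in\gamma$ we have $((u,u'),a,(v,v'))\in E^{G\to H}$ for some $v'\in V_H$; and for each $((u,u'),a,(v,v'))\in E^{G\to H}$ there exists $\gamma\in\mathcal{C}(u)$ with $(u,a,v)\in\gamma$ such that for each $(u,b,w)\in\gamma$ we have $((u,u'),b,(w,w'))\in E^{G\to H}$ for some $w'\in V_H$. (LGS5): for each $(u,u')\in V^{G\to H}$ and each $v\in\mathcal{M}$, if $G$ contains a path from $u$ to $v$, then there exists $v'\in V_H$ such that $S$ contains a path from $(u,u')$ to $(v,v')$.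
   Context: A host graph is a triple $(\Sigma,V,E)$ with $\Sigma$ a finite alphabet, $V$ a finite set of nodes and $E\subseteq V\times\Sigma\times V$. For an edge $e=(v,l,v')$, $s(e)=v$, $\sigma(e)=l$, $t(e)=v'$; $\mathrm{in}(v)=\{e\mid t(e)=v\}$, $\mathrm{out}(v)=\{e\mid s(e)=v\}$. A path is a finite nonempty sequence of edges $(e_0,\dots,e_n)$ with $s(e_i)=t(e_{i-1})$ for $1\le i\le n$; it goes from $s(e_0)$ to $t(e_n)$. A guest is a tuple $(\Sigma,V,E,\mathcal{M},\mathcal{U},\mathcal{X},\mathcal{C})$ where $(\Sigma,V,E)$ is a host graph, $\mathcal{M},\mathcal{U},\mathcal{X}\subseteq V$ (the must, unique and exclusive sets), and $\mathcal{C}:V\to\mathcal{P}(\mathcal{P}(E))$ satisfies $\bigcup\mathcal{C}(v)=\mathrm{out}(v)$ for each $v$. The tensor product of graphs $(\Sigma_1,V_1,E_1)$ and $(\Sigma_2,V_2,E_2)$ is $(\Sigma_1\cap\Sigma_2,V_1\times V_2,E^\times)$ with $E^\times=\{((u,u'),a,(v,v'))\mid (u,a,v)\in E_1,(u',a,v')\in E_2\}$; for a guest, the product uses its underlying graph $(\Sigma,V,E)$. -}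

module Defs where

open import Data.Nat using (ℕ)
open import Data.Fin using (Fin)
open import Data.List using (List)
open import Data.List.Membership.Propositional using (_∈_)
open import Data.Product using (Σ; ∃; _×_; _,_)
open import Relation.Binary.PropositionalEquality using (_≡_)
open import Function.Bundles using (_⇔_)

-- Labels are drawn from a global label universe ℕ; each graph has a finite
-- alphabet (a list of labels).
EdgeSet : Set → Set₁
EdgeSet V = V → ℕ → V → Set

record HostGraph : Set₁ where
  field
    alphabet : List ℕ
    nV       : ℕ
    E        : EdgeSet (Fin nV)
    E-label  : ∀ {v a w} → E v a w → a ∈ alphabet

out : {V : Set} → EdgeSet V → V → EdgeSet V
out E v s a t = E s a t × s ≡ v

-- Guest (Σ, V, E, M, U, X, C) with ⋃ C(v) = out(v).
record Guest : Set₁ where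
  field
    graph : HostGraph
  open HostGraph graph public
  field
    Must Unique Exclusive : Fin nV → Set
    C       : Fin nV → EdgeSet (Fin nV) → Set
    C-cover : ∀ v s a t → (∃ λ γ → C v γ × γ s a t) ⇔ out E v s a t

data Path {V : Set} (E : EdgeSet V) : V → V → Set where
  edge : ∀ {u a v} → E u a v → Path E u v
  _∷_  : ∀ {u a w v} → E u a w → Path E w v → Path E u v

-- Edges of the tensor product G × H (on the underlying graph of G);
-- labels of product edges automatically lie in Σ_G ∩ Σ_H.
ProdE : (G : Guest) (H : HostGraph) →
        EdgeSet (Fin (Guest.nV G) × Fin (HostGraph.nV H))
ProdE G H (u , u') a (v , v') = Guest.E G u a v × HostGraph.E H u' a v'

record SubProduct (G : Guest) (H : HostGraph) : Set₁ where
  field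
    VS : Fin (Guest.nV G) × Fin (HostGraph.nV H) → Set
    ES : EdgeSet (Fin (Guest.nV G) × Fin (HostGraph.nV H))
    ES⊆E× : ∀ {x a y} → ES x a y → ProdE G H x a y
    ES-src : ∀ {x a y} → ES x a y → VS x
    ES-tgt : ∀ {x a y} → ES x a y → VS y

-- the guest's choice function is C(x) = { out(x) } for every x
-- (equality of sets of edge-sets, edge-sets compared extensionally)
ChoiceIsOut : Guest → Set₁
ChoiceIsOut G = ∀ x (γ : EdgeSet (Fin nV)) →
                C x γ ⇔ (∀ s a t → γ s a t ⇔ out E x s a t)
  where open Guest G

module _ {G : Guest} {H : HostGraph} where
  open Guest G
  private
    VH = Fin (HostGraph.nV H)

  LGS4 : SubProduct G H → Set₁
  LGS4 S =
    (∀ u u' → VS (u , u') →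
       ∃ λ γ → C u γ × (∀ a v → γ u a v → ∃ λ (v' : VH) → ES (u , u') a (v , v')))
    ×
    (∀ u u' a v v' → ES (u , u') a (v , v') →
       ∃ λ γ → C u γ × γ u a v ×
         (∀ b w → γ u b w → ∃ λ (w' : VH) → ES (u , u') b (w , w')))
    where open SubProduct S

  LGS5 : SubProduct G H → Set
  LGS5 S =
    ∀ u u' → VS (u , u') → ∀ v → Must v → Path E u v →
      ∃ λ (v' : VH) → Path ES (u , u') (v , v')
    where open SubProduct S

module Submission where

-- When the choice function is C(x) = {out(x)}, the only
-- choice γ available at a node u is out(u) itself, so the first half of
-- (LGS4) says: from every node (u,u') of S, EVERY edge (u,a,w) of G is
-- matched by some edge ((u,u'),a,(w,w')) of S.  Call this property
-- "S lifts the edges of G".  A subgraph that lifts edges also lifts whole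
-- paths, by induction on the path: match the first edge, land on a node
-- (w,w') of S, and continue from there.  (LGS5) is the special case of
-- path lifting for paths ending in a must-node.

open import Defs
open import Data.Fin using (Fin)
open import Data.Product using (∃; _,_)
open import Relation.Binary.PropositionalEquality using (refl)
open import Function.Bundles using (Equivalence)

module _ {G : Guest} where
  open Guest G

  choice-contains-out : ChoiceIsOut G →
    ∀ {u γ a w} → C u γ → E u a w → γ u a w
  choice-contains-out choiceIsOut {u} {γ} {a} {w} γ∈C e =
    Equivalence.from (Equivalence.to (choiceIsOut u γ) γ∈C u a w) (e , refl)

module _ {G : Guest} {H : HostGraph} where
  open Guest G
  private
    VH = Fin (HostGraph.nV H)

  LiftsEdges : SubProduct G H → Set
  LiftsEdges S =
    ∀ {u u' a w} → VS (u , u') → E u a w → ∃ λ (w' : VH) → ES (u , u') a (w , w')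
    where open SubProduct S

  -- Under C(x) = {out(x)}, the first half of (LGS4) implies edge lifting:
  -- the choice it provides at u is forced to contain the given edge.
  LGS4⇒lifts-edges : (S : SubProduct G H) → ChoiceIsOut G → LGS4 S → LiftsEdges S
  LGS4⇒lifts-edges S choiceIsOut (choiceMatched , _) {u} {u'} {a} {w} uu'∈S e
    with choiceMatched u u' uu'∈S
  ... | γ , γ∈C , matched =
    matched a w (choice-contains-out {G = G} choiceIsOut γ∈C e)

  lift-path : (S : SubProduct G H) → LiftsEdges S →
    ∀ {u u' v} → SubProduct.VS S (u , u') → Path E u v →
    ∃ λ (v' : VH) → Path (SubProduct.ES S) (u , u') (v , v')
  lift-path S lifts uu'∈S (edge e) with lifts uu'∈S e
  ... | v' , f = v' , edge f
  lift-path S lifts uu'∈S (e ∷ p) with lifts uu'∈S e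
  ... | w' , f with lift-path S lifts (SubProduct.ES-tgt S f) p
  ... | v' , q = v' , (f ∷ q)

proposition1 : (G : Guest) (H : HostGraph) (S : SubProduct G H) →
    ChoiceIsOut G → LGS4 S → LGS5 S
proposition1 G H S choiceIsOut lgs4 u u' uu'∈S v _ path =
  lift-path S (LGS4⇒lifts-edges S choiceIsOut lgs4) uu'∈S path
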